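{- For every $p\in\mathbb{Z}$ and every integer $n\ge 0$, $$\beta_{n,\lambda}^{(p)}(x)=\sum_{k=0}^{n}\frac{(-\lambda)^{k}(1)_{k+1,1/\lambda}}{(k+1)^{p}}\,S_{2,-\lambda}(n,k\,|\,x-k).$$
   Context: Let $\lambda$ be a nonzero real number. For $\mu\in\mathbb{R}$, $(x)_{0,\mu}=1$, $(x)_{n,\mu}=x(x-\mu)\cdots(x-(n-1)\mu)$ for $n\ge1$, and $e_\mu^x(t)=\sum_{k\ge0}(x)_{k,\mu}t^k/k!$ (formal power series in $t$), $e_\mu(t)=e_\mu^1(t)$. For an integer $k\ge0$ the degenerate Stirling polynomials are defined by $\frac{1}{k!}(e_\mu(t)-1)^k e_\mu^x(t)=\sum_{n\ge k}S_{2,\mu}(n,k\,|\,x)\frac{t^n}{n!}$. For $k\in\mathbb{Z}$, the degenerate polylogarithm is $\mathrm{Li}_{k,\lambda}(y)=\sum_{n\ge1}\frac{(-\lambda)^{n-1}(1)_{n,1/\lambda}}{(n-1)!\,n^k}y^n$. The degenerate poly-Bernoulli polynomials of index $k$ are defined by $\frac{\mathrm{Li}_{k,\lambda}(1-e_\lambda(-t))}{1-e_\lambda(-t)}e_\lambda^{ -x}(-t)=\sum_{n\ge0}\beta^{(k)}_{n,\lambda}(x)\frac{t^n}{n!}$. -}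

module Defs where

open import Level using (Level)
open import Algebra.Bundles using (CommutativeRing)
open import Data.Nat using (ℕ; zero; suc; _∸_)
open import Data.Nat using (_!)
open import Data.Integer using (ℤ; +_; -[1+_])

-- Everything is developed over an arbitrary commutative ring R in which every
-- positive integer is invertible (a Q-algebra, e.g. the reals); the inverses
-- are supplied as data (`inv m` plays the role of 1/(m+1)) and their
-- correctness is a hypothesis of the theorem.
module Gen {c ℓ : Level} (R : CommutativeRing c ℓ) where
  open CommutativeRing R

  ι : ℕ → Carrier
  ι zero = 0#
  ι (suc n) = 1# + ι n

  sumTo : ℕ → (ℕ → Carrier) → Carrier
  sumTo zero f = f 0
  sumTo (suc n) f = sumTo n f + f (suc n)

  pow : Carrier → ℕ → Carrier
  pow a zero = 1#
  pow a (suc n) = pow a n * a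

  fall : Carrier → ℕ → Carrier → Carrier
  fall x zero μ = 1#
  fall x (suc n) μ = fall x n μ * (x - ι n * μ)

  fact : ℕ → Carrier
  fact n = ι (n !)

  invFact : (ℕ → Carrier) → ℕ → Carrier
  invFact inv zero = 1#
  invFact inv (suc n) = invFact inv n * inv n

  -- 1/(m+1)^p for p ∈ ℤ
  invPowZ : (ℕ → Carrier) → ℕ → ℤ → Carrier
  invPowZ inv m (+ n) = pow (inv m) n
  invPowZ inv m (-[1+ n ]) = pow (ι (suc m)) (suc n)

  -- formal power series in t: n ↦ coefficient of t^n
  Series : Set c
  Series = ℕ → Carrier

  oneS : Series
  oneS zero = 1#
  oneS (suc n) = 0#

  _⊕_ : Series → Series → Series
  (f ⊕ g) n = f n + g n

  ⊖_ : Series → Series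
  (⊖ f) n = - f n

  _⊛_ : Series → Series → Series
  (f ⊛ g) n = sumTo n (λ i → f i * g (n ∸ i))

  spow : Series → ℕ → Series
  spow f zero = oneS
  spow f (suc m) = spow f m ⊛ f

  -- substitution y ↦ Σ_m a_m y^m for a series y with zero constant term
  -- (only y^0, ..., y^n contribute to the coefficient of t^n)
  subst : (ℕ → Carrier) → Series → Series
  subst a y n = sumTo n (λ m → a m * spow y m n)

  negT : Series → Series
  negT f n = pow (- 1#) n * f n

  -- e_μ^x(t) = Σ_k (x)_{k,μ} t^k / k!
  expS : (ℕ → Carrier) → Carrier → Carrier → Series
  expS inv μ x k = fall x k μ * invFact inv k

  -- degenerate Stirling polynomial S_{2,μ}(n,k | x):
  -- n! [t^n] (1/k!) (e_μ(t) - 1)^k e_μ^x(t)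
  S2 : (ℕ → Carrier) → Carrier → ℕ → ℕ → Carrier → Carrier
  S2 inv μ n k x =
    fact n * (invFact inv k * (spow (expS inv μ 1# ⊕ (⊖ oneS)) k ⊛ expS inv μ x) n)

  -- Li_{p,λ}(y)/y = Σ_{m≥0} (-λ)^m (1)_{m+1,1/λ} / (m! (m+1)^p) y^m
  -- (lam = λ, lamInv = 1/λ)
  LiOverYCoeff : (ℕ → Carrier) → Carrier → Carrier → ℤ → ℕ → Carrier
  LiOverYCoeff inv lam lamInv p m =
    pow (- lam) m * fall 1# (suc m) lamInv * invFact inv m * invPowZ inv m p

  -- degenerate poly-Bernoulli polynomial β^{(p)}_{n,λ}(x):
  -- n! [t^n] (Li_{p,λ}(1 - e_λ(-t)) / (1 - e_λ(-t))) e_λ^{-x}(-t)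
  β : (ℕ → Carrier) → Carrier → Carrier → ℤ → ℕ → Carrier → Carrier
  β inv lam lamInv p n x =
    fact n * ((subst (LiOverYCoeff inv lam lamInv p)
                     (oneS ⊕ (⊖ negT (expS inv lam 1#)))
              ⊛ negT (expS inv lam (- x))) n)

-- Write e^a for e^a_{-λ}(t).  Since e_λ^y(-t) = e^{-y}, the generating function of β is
-- f(u) e^x with f(y) = Li_{p,λ}(y)/y = Σ_k c_k y^k and u = 1 - e^{-1}.  The exponentials
-- satisfy e^a e^b = e^{a+b} (both sides solve the same first-order recurrence), hence
-- (1 - e^{-1}) e^x = (e - 1) e^{x-1} and, inductively, u^k e^x = (e - 1)^k e^{x-k}.
-- Reading off the coefficient of t^n gives Σ_k c_k k! S_{2,-λ}(n, k | x - k).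
module Submission where

open import Defs
open import Level using (Level)
open import Algebra.Bundles using (CommutativeRing)
open import Data.Nat using (ℕ; suc)
open import Data.Integer using (ℤ)

open import Data.Nat as ℕ using (zero; _≤_; _<_; _∸_; z≤n; _<?_)
import Data.Nat.Properties as ℕP
open import Data.Sum using (inj₁; inj₂)
open import Relation.Nullary using (yes; no)
open import Relation.Binary.Bundles using (Setoid)
import Relation.Binary.PropositionalEquality as P
import Relation.Binary.Reasoning.Setoid as SetoidReasoning
import Algebra.Properties.CommutativeSemigroup as CommutativeSemigroupProperties

module PolyBernoulli {c ℓ : Level} (R : CommutativeRing c ℓ) where
  open CommutativeRing R
  open Gen R
  open import Algebra.Properties.Ring ring
    using (-‿distribˡ-*; -‿distribʳ-*; -‿involutive; -0#≈0#; -1*x≈-x)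
  open import Algebra.Properties.AbelianGroup +-abelianGroup using (⁻¹-∙-comm; xyx⁻¹≈y)
  open CommutativeSemigroupProperties +-commutativeSemigroup using ()
    renaming (interchange to +-interchange)
  open CommutativeSemigroupProperties *-commutativeSemigroup using (xy∙z≈y∙xz)
    renaming (interchange to *-interchange)
  open import Algebra.Solver.Ring.NaturalCoefficients.Default commutativeSemiring
    using (solve; _:=_; _:+_; _:*_)
  open SetoidReasoning setoid

  ι-+ : ∀ m n → ι (m ℕ.+ n) ≈ ι m + ι n
  ι-+ zero n = sym (+-identityˡ _)
  ι-+ (suc m) n = trans (+-congˡ (ι-+ m n)) (sym (+-assoc _ _ _))

  ι-split : ∀ {i n} → i ≤ n → ι n ≈ ι i + ι (n ∸ i)
  ι-split {i} {n} i≤n = trans (reflexive (P.cong ι (P.sym (ℕP.m+[n∸m]≡n i≤n)))) (ι-+ i (n ∸ i))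

  *-cancelˡ-invertible : ∀ {a a⁻¹ x y} → a * a⁻¹ ≈ 1# → a * x ≈ a * y → x ≈ y
  *-cancelˡ-invertible {a} {a⁻¹} {x} {y} aa⁻¹≈1 ax≈ay = begin
    x                ≈⟨ sym (*-identityˡ x) ⟩
    1# * x           ≈⟨ *-congʳ (sym aa⁻¹≈1) ⟩
    (a * a⁻¹) * x    ≈⟨ xy∙z≈y∙xz a a⁻¹ x ⟩
    a⁻¹ * (a * x)    ≈⟨ *-congˡ ax≈ay ⟩
    a⁻¹ * (a * y)    ≈⟨ sym (xy∙z≈y∙xz a a⁻¹ y) ⟩
    (a * a⁻¹) * y    ≈⟨ *-congʳ aa⁻¹≈1 ⟩
    1# * y           ≈⟨ *-identityˡ y ⟩
    y                ∎

  -- Finite sums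

  sumTo-cong-≤ : ∀ n {f g : ℕ → Carrier} → (∀ i → i ≤ n → f i ≈ g i) →
                 sumTo n f ≈ sumTo n g
  sumTo-cong-≤ zero f≈g = f≈g 0 z≤n
  sumTo-cong-≤ (suc n) f≈g =
    +-cong (sumTo-cong-≤ n (λ i i≤n → f≈g i (ℕP.m≤n⇒m≤1+n i≤n))) (f≈g (suc n) ℕP.≤-refl)

  sumTo-cong : ∀ n {f g : ℕ → Carrier} → (∀ i → f i ≈ g i) → sumTo n f ≈ sumTo n g
  sumTo-cong n f≈g = sumTo-cong-≤ n (λ i _ → f≈g i)

  sumTo-zero : ∀ n {f : ℕ → Carrier} → (∀ i → i ≤ n → f i ≈ 0#) → sumTo n f ≈ 0#
  sumTo-zero n {f} f≈0 = trans (sumTo-cong-≤ n f≈0) (zeros n)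
    where
    zeros : ∀ m → sumTo m (λ _ → 0#) ≈ 0#
    zeros zero = refl
    zeros (suc m) = trans (+-identityʳ _) (zeros m)

  sumTo-+ : ∀ n (f g : ℕ → Carrier) → sumTo n (λ i → f i + g i) ≈ sumTo n f + sumTo n g
  sumTo-+ zero f g = refl
  sumTo-+ (suc n) f g = trans (+-congʳ (sumTo-+ n f g)) (+-interchange _ _ _ _)

  *-distribˡ-sumTo : ∀ n a (f : ℕ → Carrier) → a * sumTo n f ≈ sumTo n (λ i → a * f i)
  *-distribˡ-sumTo zero a f = refl
  *-distribˡ-sumTo (suc n) a f = trans (distribˡ _ _ _) (+-congʳ (*-distribˡ-sumTo n a f))

  *-distribʳ-sumTo : ∀ n a (f : ℕ → Carrier) → sumTo n f * a ≈ sumTo n (λ i → f i * a)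
  *-distribʳ-sumTo zero a f = refl
  *-distribʳ-sumTo (suc n) a f = trans (distribʳ _ _ _) (+-congʳ (*-distribʳ-sumTo n a f))

  -‿distrib-sumTo : ∀ n (f : ℕ → Carrier) → - sumTo n f ≈ sumTo n (λ i → - f i)
  -‿distrib-sumTo zero f = refl
  -‿distrib-sumTo (suc n) f = trans (sym (⁻¹-∙-comm _ _)) (+-congʳ (-‿distrib-sumTo n f))

  sumTo-suc : ∀ n (f : ℕ → Carrier) → sumTo (suc n) f ≈ f 0 + sumTo n (λ i → f (suc i))
  sumTo-suc zero f = refl
  sumTo-suc (suc n) f = trans (+-congʳ (sumTo-suc n f)) (+-assoc _ _ _)

  sumTo-reverse : ∀ n (f : ℕ → Carrier) → sumTo n f ≈ sumTo n (λ i → f (n ∸ i))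
  sumTo-reverse zero f = refl
  sumTo-reverse (suc n) f = begin
    sumTo n f + f (suc n)                    ≈⟨ +-comm _ _ ⟩
    f (suc n) + sumTo n f                    ≈⟨ +-congˡ (sumTo-reverse n f) ⟩
    f (suc n) + sumTo n (λ i → f (n ∸ i))    ≈⟨ sym (sumTo-suc n (λ i → f (suc n ∸ i))) ⟩
    sumTo (suc n) (λ i → f (suc n ∸ i))      ∎

  sumTo-vanishing-tail : ∀ {f : ℕ → Carrier} {j} N → j ≤ N →
                         (∀ i → j < i → i ≤ N → f i ≈ 0#) → sumTo N f ≈ sumTo j f
  sumTo-vanishing-tail {j = zero} zero z≤n _ = refl
  sumTo-vanishing-tail {f} {j} (suc N) j≤1+N tail≈0 with ℕP.m≤n⇒m<n∨m≡n j≤1+N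
  ... | inj₂ P.refl = refl
  ... | inj₁ j<1+N = begin
    sumTo N f + f (suc N)
      ≈⟨ +-cong (sumTo-vanishing-tail N (ℕP.≤-pred j<1+N)
                  (λ i j<i i≤N → tail≈0 i j<i (ℕP.m≤n⇒m≤1+n i≤N)))
                (tail≈0 (suc N) j<1+N ℕP.≤-refl) ⟩
    sumTo j f + 0#  ≈⟨ +-identityʳ _ ⟩
    sumTo j f       ∎

  sumTo-swap : ∀ n N (F : ℕ → ℕ → Carrier) →
               sumTo n (λ i → sumTo N (F i)) ≈ sumTo N (λ m → sumTo n (λ i → F i m))
  sumTo-swap zero N F = refl
  sumTo-swap (suc n) N F = trans (+-congʳ (sumTo-swap n N F)) (sym (sumTo-+ N _ _))

  sumTo-swap-triangle : ∀ n (F : ℕ → ℕ → Carrier) →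
    sumTo n (λ i → sumTo i (λ j → F j (i ∸ j))) ≈ sumTo n (λ j → sumTo (n ∸ j) (F j))
  sumTo-swap-triangle zero F = refl
  sumTo-swap-triangle (suc n) F = begin
    sumTo n (λ i → sumTo i (λ j → F j (i ∸ j)))
      + (sumTo n (λ j → F j (suc n ∸ j)) + F (suc n) (n ∸ n))
      ≈⟨ +-cong (sumTo-swap-triangle n F)
                (+-cong (sumTo-cong-≤ n (λ j j≤n → reflexive (P.cong (F j) (ℕP.+-∸-assoc 1 j≤n))))
                        (reflexive (P.cong (F (suc n)) (ℕP.n∸n≡0 n)))) ⟩
    sumTo n (λ j → sumTo (n ∸ j) (F j)) + (sumTo n (λ j → F j (suc (n ∸ j))) + F (suc n) 0)
      ≈⟨ sym (+-assoc _ _ _) ⟩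
    (sumTo n (λ j → sumTo (n ∸ j) (F j)) + sumTo n (λ j → F j (suc (n ∸ j)))) + F (suc n) 0
      ≈⟨ +-congʳ (sym (sumTo-+ n _ _)) ⟩
    sumTo n (λ j → sumTo (suc (n ∸ j)) (F j)) + F (suc n) 0
      ≈⟨ +-congʳ (sumTo-cong-≤ n (λ j j≤n →
           reflexive (P.cong (λ t → sumTo t (F j)) (P.sym (ℕP.+-∸-assoc 1 j≤n))))) ⟩
    sumTo n (λ j → sumTo (suc n ∸ j) (F j)) + sumTo 0 (F (suc n))
      ≈⟨ +-congˡ (reflexive (P.cong (λ t → sumTo t (F (suc n))) (P.sym (ℕP.n∸n≡0 n)))) ⟩
    sumTo (suc n) (λ j → sumTo (suc n ∸ j) (F j)) ∎

  -- Formal power series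

  infix 4 _≋_
  _≋_ : Series → Series → Set ℓ
  f ≋ g = ∀ n → f n ≈ g n

  ≋-refl : ∀ {f} → f ≋ f
  ≋-refl _ = refl

  ≋-sym : ∀ {f g} → f ≋ g → g ≋ f
  ≋-sym f≋g n = sym (f≋g n)

  ≋-trans : ∀ {f g h} → f ≋ g → g ≋ h → f ≋ h
  ≋-trans f≋g g≋h n = trans (f≋g n) (g≋h n)

  ≋-setoid : Setoid c ℓ
  ≋-setoid = record
    { Carrier = Series
    ; _≈_ = _≋_
    ; isEquivalence = record { refl = ≋-refl ; sym = ≋-sym ; trans = ≋-trans }
    }

  module ≋R = SetoidReasoning ≋-setoid

  ⊕-cong : ∀ {f f′ g g′} → f ≋ f′ → g ≋ g′ → (f ⊕ g) ≋ (f′ ⊕ g′)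
  ⊕-cong f≋f′ g≋g′ n = +-cong (f≋f′ n) (g≋g′ n)

  ⊖-cong : ∀ {f f′} → f ≋ f′ → (⊖ f) ≋ (⊖ f′)
  ⊖-cong f≋f′ n = -‿cong (f≋f′ n)

  ⊛-cong : ∀ {f f′ g g′} → f ≋ f′ → g ≋ g′ → (f ⊛ g) ≋ (f′ ⊛ g′)
  ⊛-cong f≋f′ g≋g′ n = sumTo-cong n (λ i → *-cong (f≋f′ i) (g≋g′ (n ∸ i)))

  spow-cong : ∀ {f g} → f ≋ g → ∀ m → spow f m ≋ spow g m
  spow-cong f≋g zero = ≋-refl
  spow-cong f≋g (suc m) = ⊛-cong (spow-cong f≋g m) f≋g

  subst-cong : ∀ a {y y′} → y ≋ y′ → subst a y ≋ subst a y′
  subst-cong a y≋y′ n = sumTo-cong n (λ m → *-congˡ (spow-cong y≋y′ m n))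

  ⊛-identityˡ : ∀ f → (oneS ⊛ f) ≋ f
  ⊛-identityˡ f zero = *-identityˡ _
  ⊛-identityˡ f (suc n) = begin
    sumTo (suc n) (λ i → oneS i * f (suc n ∸ i))      ≈⟨ sumTo-suc n _ ⟩
    1# * f (suc n) + sumTo n (λ i → 0# * f (n ∸ i))
      ≈⟨ +-cong (*-identityˡ _) (sumTo-zero n (λ i _ → zeroˡ _)) ⟩
    f (suc n) + 0#                                    ≈⟨ +-identityʳ _ ⟩
    f (suc n)                                         ∎

  ⊛-comm : ∀ f g → (f ⊛ g) ≋ (g ⊛ f)
  ⊛-comm f g n = begin
    sumTo n (λ i → f i * g (n ∸ i))               ≈⟨ sumTo-reverse n _ ⟩
    sumTo n (λ i → f (n ∸ i) * g (n ∸ (n ∸ i)))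
      ≈⟨ sumTo-cong-≤ n (λ i i≤n →
           trans (*-congˡ (reflexive (P.cong g (ℕP.m∸[m∸n]≡n i≤n)))) (*-comm _ _)) ⟩
    sumTo n (λ i → g i * f (n ∸ i))               ∎

  ⊛-assoc : ∀ f g h → ((f ⊛ g) ⊛ h) ≋ (f ⊛ (g ⊛ h))
  ⊛-assoc f g h n = begin
    sumTo n (λ i → sumTo i (λ j → f j * g (i ∸ j)) * h (n ∸ i))
      ≈⟨ sumTo-cong n (λ i → *-distribʳ-sumTo i _ _) ⟩
    sumTo n (λ i → sumTo i (λ j → (f j * g (i ∸ j)) * h (n ∸ i)))
      ≈⟨ sumTo-cong-≤ n (λ i i≤n → sumTo-cong-≤ i (λ j j≤i →
           trans (*-assoc _ _ _)
                 (*-congˡ (*-congˡ (reflexive (P.cong h (n∸i≡n∸j∸[i∸j] i≤n j≤i))))))) ⟩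
    sumTo n (λ i → sumTo i (λ j → F j (i ∸ j)))  ≈⟨ sumTo-swap-triangle n F ⟩
    sumTo n (λ j → sumTo (n ∸ j) (F j))
      ≈⟨ sumTo-cong n (λ j → sym (*-distribˡ-sumTo (n ∸ j) _ _)) ⟩
    sumTo n (λ j → f j * sumTo (n ∸ j) (λ k → g k * h (n ∸ j ∸ k))) ∎
    where
    F : ℕ → ℕ → Carrier
    F j k = f j * (g k * h (n ∸ j ∸ k))
    n∸i≡n∸j∸[i∸j] : ∀ {i j} → i ≤ n → j ≤ i → n ∸ i P.≡ n ∸ j ∸ (i ∸ j)
    n∸i≡n∸j∸[i∸j] {i} {j} _ j≤i =
      P.trans (P.cong (n ∸_) (P.sym (ℕP.m+[n∸m]≡n j≤i))) (P.sym (ℕP.∸-+-assoc n j (i ∸ j)))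

  ⊛-distribʳ-⊕ : ∀ f g h → ((f ⊕ g) ⊛ h) ≋ ((f ⊛ h) ⊕ (g ⊛ h))
  ⊛-distribʳ-⊕ f g h n = trans (sumTo-cong n (λ i → distribʳ _ _ _)) (sumTo-+ n _ _)

  ⊖-distribˡ-⊛ : ∀ f g → ((⊖ f) ⊛ g) ≋ (⊖ (f ⊛ g))
  ⊖-distribˡ-⊛ f g n =
    trans (sumTo-cong n (λ i → sym (-‿distribˡ-* _ _))) (sym (-‿distrib-sumTo n _))

  deriv : Series → Series
  deriv f k = ι (suc k) * f (suc k)

  deriv-⊛ : ∀ f g → deriv (f ⊛ g) ≋ ((deriv f ⊛ g) ⊕ (f ⊛ deriv g))
  deriv-⊛ f g n = begin
    ι (suc n) * sumTo (suc n) (λ i → f i * g (suc n ∸ i))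
      ≈⟨ *-distribˡ-sumTo (suc n) _ _ ⟩
    sumTo (suc n) (λ i → ι (suc n) * (f i * g (suc n ∸ i)))
      ≈⟨ sumTo-cong-≤ (suc n) (λ i i≤1+n →
           trans (*-congʳ (ι-split i≤1+n)) (leibniz _ _ _ _)) ⟩
    sumTo (suc n) (λ i → (ι i * f i) * g (suc n ∸ i) + f i * (ι (suc n ∸ i) * g (suc n ∸ i)))
      ≈⟨ sumTo-+ (suc n) _ _ ⟩
    sumTo (suc n) (λ i → (ι i * f i) * g (suc n ∸ i))
      + sumTo (suc n) (λ i → f i * (ι (suc n ∸ i) * g (suc n ∸ i)))
      ≈⟨ +-cong derivˡ derivʳ ⟩
    (deriv f ⊛ g) n + (f ⊛ deriv g) n ∎
    where
    leibniz : ∀ x y p q → (x + y) * (p * q) ≈ (x * p) * q + p * (y * q)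
    leibniz = solve 4 (λ x y p q → ((x :+ y) :* (p :* q)) := ((x :* p) :* q :+ p :* (y :* q)))
                      refl

    derivˡ : sumTo (suc n) (λ i → (ι i * f i) * g (suc n ∸ i)) ≈ (deriv f ⊛ g) n
    derivˡ = begin
      sumTo (suc n) (λ i → (ι i * f i) * g (suc n ∸ i))  ≈⟨ sumTo-suc n _ ⟩
      (0# * f 0) * g (suc n) + (deriv f ⊛ g) n  ≈⟨ +-congʳ (trans (*-congʳ (zeroˡ _)) (zeroˡ _)) ⟩
      0# + (deriv f ⊛ g) n                      ≈⟨ +-identityˡ _ ⟩
      (deriv f ⊛ g) n                           ∎

    derivʳ : sumTo (suc n) (λ i → f i * (ι (suc n ∸ i) * g (suc n ∸ i))) ≈ (f ⊛ deriv g) n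
    derivʳ = begin
      sumTo n (λ i → f i * (ι (suc n ∸ i) * g (suc n ∸ i))) + f (suc n) * (ι (n ∸ n) * g (n ∸ n))
        ≈⟨ +-cong (sumTo-cong-≤ n (λ i i≤n →
                     reflexive (P.cong (λ t → f i * (ι t * g t)) (ℕP.+-∸-assoc 1 i≤n))))
                  (trans (*-congˡ (trans (*-congʳ (reflexive (P.cong ι (ℕP.n∸n≡0 n)))) (zeroˡ _)))
                         (zeroʳ _)) ⟩
      (f ⊛ deriv g) n + 0#  ≈⟨ +-identityʳ _ ⟩
      (f ⊛ deriv g) n       ∎

  spow-vanishes : ∀ {y} → y 0 ≈ 0# → ∀ m j → j < m → spow y m j ≈ 0#
  spow-vanishes {y} y₀≈0 (suc m) j j<1+m = sumTo-zero j term≈0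
    where
    term≈0 : ∀ i → i ≤ j → spow y m i * y (j ∸ i) ≈ 0#
    term≈0 i i≤j with i <? m
    ... | yes i<m = trans (*-congʳ (spow-vanishes y₀≈0 m i i<m)) (zeroˡ _)
    ... | no i≮m  = trans (*-congˡ (trans (reflexive (P.cong y j∸i≡0)) y₀≈0)) (zeroʳ _)
      where
      j∸i≡0 : j ∸ i P.≡ 0
      j∸i≡0 = ℕP.m≤n⇒m∸n≡0 (ℕP.≤-trans (ℕP.≤-pred j<1+m) (ℕP.≮⇒≥ i≮m))

  subst-⊛ : ∀ {y} → y 0 ≈ 0# → ∀ a g n →
            (subst a y ⊛ g) n ≈ sumTo n (λ m → a m * (spow y m ⊛ g) n)
  subst-⊛ {y} y₀≈0 a g n = begin
    sumTo n (λ i → sumTo i (λ m → a m * spow y m i) * g (n ∸ i))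
      ≈⟨ sumTo-cong-≤ n (λ i i≤n → *-congʳ (sym (sumTo-vanishing-tail n i≤n
           (λ m i<m _ → trans (*-congˡ (spow-vanishes y₀≈0 m i i<m)) (zeroʳ _))))) ⟩
    sumTo n (λ i → sumTo n (λ m → a m * spow y m i) * g (n ∸ i))
      ≈⟨ sumTo-cong n (λ i → *-distribʳ-sumTo n _ _) ⟩
    sumTo n (λ i → sumTo n (λ m → (a m * spow y m i) * g (n ∸ i)))
      ≈⟨ sumTo-swap n n _ ⟩
    sumTo n (λ m → sumTo n (λ i → (a m * spow y m i) * g (n ∸ i)))
      ≈⟨ sumTo-cong n (λ m →
           trans (sumTo-cong n (λ i → *-assoc _ _ _)) (sym (*-distribˡ-sumTo n _ _))) ⟩
    sumTo n (λ m → a m * (spow y m ⊛ g) n) ∎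

  -- Degenerate exponentials

  fall-cong : ∀ {x y} μ k → x ≈ y → fall x k μ ≈ fall y k μ
  fall-cong μ zero x≈y = refl
  fall-cong μ (suc k) x≈y = *-cong (fall-cong μ k x≈y) (+-congʳ x≈y)

  sign-fall : ∀ y k lam → pow (- 1#) k * fall y k lam ≈ fall (- y) k (- lam)
  sign-fall y zero lam = *-identityˡ 1#
  sign-fall y (suc k) lam = begin
    (pow (- 1#) k * - 1#) * (fall y k lam * (y - ι k * lam))
      ≈⟨ *-interchange _ _ _ _ ⟩
    (pow (- 1#) k * fall y k lam) * (- 1# * (y - ι k * lam))
      ≈⟨ *-cong (sign-fall y k lam) (trans (-1*x≈-x _) (sym (⁻¹-∙-comm _ _))) ⟩
    fall (- y) k (- lam) * (- y + - - (ι k * lam))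
      ≈⟨ *-congˡ (+-congˡ (-‿cong (-‿distribʳ-* (ι k) lam))) ⟩
    fall (- y) k (- lam) * (- y - ι k * - lam) ∎

  negT-expS : ∀ inv lam y → negT (expS inv lam y) ≋ expS inv (- lam) (- y)
  negT-expS inv lam y k = trans (sym (*-assoc _ _ _)) (*-congʳ (sign-fall y k lam))

  module DegenerateExponential
    (inv : ℕ → Carrier) (inv-correct : ∀ m → ι (suc m) * inv m ≈ 1#) (μ : Carrier) where

    E : Carrier → Series
    E = expS inv μ

    E-cong : ∀ {a b} → a ≈ b → E a ≋ E b
    E-cong a≈b k = *-congʳ (fall-cong μ k a≈b)

    deriv-E : ∀ a k → deriv (E a) k ≈ (a - ι k * μ) * E a k
    deriv-E a k = begin
      ι (suc k) * ((fall a k μ * (a - ι k * μ)) * (invFact inv k * inv k))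
        ≈⟨ rearrange (ι (suc k)) (fall a k μ) (a - ι k * μ) (invFact inv k) (inv k) ⟩
      (ι (suc k) * inv k) * ((a - ι k * μ) * E a k)  ≈⟨ *-congʳ (inv-correct k) ⟩
      1# * ((a - ι k * μ) * E a k)                   ≈⟨ *-identityˡ _ ⟩
      (a - ι k * μ) * E a k                          ∎
      where
      rearrange : ∀ s F d G v → s * ((F * d) * (G * v)) ≈ (s * v) * (d * (F * G))
      rearrange = solve 5 (λ s F d G v →
                    (s :* ((F :* d) :* (G :* v))) := ((s :* v) :* (d :* (F :* G)))) refl

    E-unique : ∀ a G → G 0 ≈ 1# → (∀ k → deriv G k ≈ (a - ι k * μ) * G k) → G ≋ E a
    E-unique a G G₀≈1 deriv-G zero = trans G₀≈1 (sym (*-identityˡ 1#))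
    E-unique a G G₀≈1 deriv-G (suc k) = *-cancelˡ-invertible (inv-correct k)
      (trans (deriv-G k) (trans (*-congˡ (E-unique a G G₀≈1 deriv-G k)) (sym (deriv-E a k))))

    rate-+ : ∀ a b {i n} → i ≤ n → (a - ι i * μ) + (b - ι (n ∸ i) * μ) ≈ (a + b) - ι n * μ
    rate-+ a b {i} {n} i≤n = begin
      (a - ι i * μ) + (b - ι (n ∸ i) * μ)       ≈⟨ +-interchange _ _ _ _ ⟩
      (a + b) + (- (ι i * μ) - ι (n ∸ i) * μ)   ≈⟨ +-congˡ (⁻¹-∙-comm _ _) ⟩
      (a + b) - (ι i * μ + ι (n ∸ i) * μ)       ≈⟨ +-congˡ (-‿cong (sym (distribʳ μ _ _))) ⟩
      (a + b) - (ι i + ι (n ∸ i)) * μ           ≈⟨ +-congˡ (-‿cong (*-congʳ (sym (ι-split i≤n)))) ⟩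
      (a + b) - ι n * μ                         ∎

    E-+ : ∀ a b → (E a ⊛ E b) ≋ E (a + b)
    E-+ a b = E-unique (a + b) (E a ⊛ E b) product₀≈1 deriv-product
      where
      product₀≈1 : (E a ⊛ E b) 0 ≈ 1#
      product₀≈1 = trans (*-cong (*-identityˡ 1#) (*-identityˡ 1#)) (*-identityˡ 1#)

      factor : ∀ α β p q → (α * p) * q + p * (β * q) ≈ (α + β) * (p * q)
      factor = solve 4 (λ α β p q → ((α :* p) :* q :+ p :* (β :* q)) := ((α :+ β) :* (p :* q)))
                       refl

      deriv-product : ∀ n → deriv (E a ⊛ E b) n ≈ (a + b - ι n * μ) * (E a ⊛ E b) n
      deriv-product n = begin
        deriv (E a ⊛ E b) n  ≈⟨ deriv-⊛ (E a) (E b) n ⟩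
        (deriv (E a) ⊛ E b) n + (E a ⊛ deriv (E b)) n  ≈⟨ sym (sumTo-+ n _ _) ⟩
        sumTo n (λ i → deriv (E a) i * E b (n ∸ i) + E a i * deriv (E b) (n ∸ i))
          ≈⟨ sumTo-cong-≤ n (λ i i≤n → begin
               deriv (E a) i * E b (n ∸ i) + E a i * deriv (E b) (n ∸ i)
                 ≈⟨ +-cong (*-congʳ (deriv-E a i)) (*-congˡ (deriv-E b (n ∸ i))) ⟩
               ((a - ι i * μ) * E a i) * E b (n ∸ i)
                 + E a i * ((b - ι (n ∸ i) * μ) * E b (n ∸ i))
                 ≈⟨ factor _ _ _ _ ⟩
               ((a - ι i * μ) + (b - ι (n ∸ i) * μ)) * (E a i * E b (n ∸ i))
                 ≈⟨ *-congʳ (rate-+ a b i≤n) ⟩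
               (a + b - ι n * μ) * (E a i * E b (n ∸ i)) ∎) ⟩
        sumTo n (λ i → (a + b - ι n * μ) * (E a i * E b (n ∸ i)))
          ≈⟨ sym (*-distribˡ-sumTo n _ _) ⟩
        (a + b - ι n * μ) * (E a ⊛ E b) n ∎

    u v : Series
    u = oneS ⊕ (⊖ E (- 1#))
    v = E 1# ⊕ (⊖ oneS)

    u₀≈0 : u 0 ≈ 0#
    u₀≈0 = trans (+-congˡ (-‿cong (*-identityˡ 1#))) (-‿inverseʳ 1#)

    u⊛E≋v⊛E : ∀ x → (u ⊛ E x) ≋ (v ⊛ E (x - 1#))
    u⊛E≋v⊛E x = ≋R.begin
      u ⊛ E x  ≋R.≈⟨ ⊛-distribʳ-⊕ oneS (⊖ E (- 1#)) (E x) ⟩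
      (oneS ⊛ E x) ⊕ ((⊖ E (- 1#)) ⊛ E x)
        ≋R.≈⟨ ⊕-cong (⊛-identityˡ (E x)) (⊖-distribˡ-⊛ (E (- 1#)) (E x)) ⟩
      E x ⊕ (⊖ (E (- 1#) ⊛ E x))
        ≋R.≈⟨ ⊕-cong ≋-refl (⊖-cong (≋-trans (E-+ (- 1#) x) (E-cong (+-comm _ _)))) ⟩
      E x ⊕ (⊖ E (x - 1#))
        ≋R.≈⟨ ⊕-cong (≋-trans (E-cong (sym 1+[x-1]≈x)) (≋-sym (E-+ 1# (x - 1#))))
                     (⊖-cong (≋-sym (⊛-identityˡ (E (x - 1#))))) ⟩
      (E 1# ⊛ E (x - 1#)) ⊕ (⊖ (oneS ⊛ E (x - 1#)))
        ≋R.≈⟨ ⊕-cong ≋-refl (≋-sym (⊖-distribˡ-⊛ oneS (E (x - 1#)))) ⟩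
      (E 1# ⊛ E (x - 1#)) ⊕ ((⊖ oneS) ⊛ E (x - 1#))
        ≋R.≈⟨ ≋-sym (⊛-distribʳ-⊕ (E 1#) (⊖ oneS) (E (x - 1#))) ⟩
      v ⊛ E (x - 1#) ≋R.∎
      where
      1+[x-1]≈x : 1# + (x - 1#) ≈ x
      1+[x-1]≈x = trans (sym (+-assoc _ _ _)) (xyx⁻¹≈y 1# x)

    spow-u⊛E : ∀ m x → (spow u m ⊛ E x) ≋ (spow v m ⊛ E (x - ι m))
    spow-u⊛E zero x = ⊛-cong ≋-refl (E-cong (sym x-0≈x))
      where
      x-0≈x : x - 0# ≈ x
      x-0≈x = trans (+-congˡ -0#≈0#) (+-identityʳ x)
    spow-u⊛E (suc m) x = ≋R.begin
      (spow u m ⊛ u) ⊛ E x               ≋R.≈⟨ ⊛-assoc (spow u m) u (E x) ⟩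
      spow u m ⊛ (u ⊛ E x)
        ≋R.≈⟨ ⊛-cong ≋-refl (≋-trans (u⊛E≋v⊛E x) (⊛-comm v (E (x - 1#)))) ⟩
      spow u m ⊛ (E (x - 1#) ⊛ v)        ≋R.≈⟨ ≋-sym (⊛-assoc (spow u m) (E (x - 1#)) v) ⟩
      (spow u m ⊛ E (x - 1#)) ⊛ v
        ≋R.≈⟨ ⊛-cong (≋-trans (spow-u⊛E m (x - 1#)) (⊛-cong ≋-refl (E-cong x-1-m≈x-[1+m])))
                     (≋-refl {v}) ⟩
      (spow v m ⊛ E x′) ⊛ v              ≋R.≈⟨ ⊛-assoc (spow v m) (E x′) v ⟩
      spow v m ⊛ (E x′ ⊛ v)              ≋R.≈⟨ ⊛-cong ≋-refl (⊛-comm (E x′) v) ⟩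
      spow v m ⊛ (v ⊛ E x′)              ≋R.≈⟨ ≋-sym (⊛-assoc (spow v m) v (E x′)) ⟩
      (spow v m ⊛ v) ⊛ E x′              ≋R.∎
      where
      x′ : Carrier
      x′ = x - ι (suc m)
      x-1-m≈x-[1+m] : x - 1# - ι m ≈ x′
      x-1-m≈x-[1+m] = trans (+-assoc _ _ _) (+-congˡ (⁻¹-∙-comm 1# (ι m)))

  β-Stirling-expansion :
    (inv : ℕ → Carrier) → (∀ m → ι (suc m) * inv m ≈ 1#) →
    (lam lamInv : Carrier) (p : ℤ) (n : ℕ) (x : Carrier) →
    β inv lam lamInv p n x ≈
      sumTo n (λ k → pow (- lam) k * fall 1# (suc k) lamInv * invPowZ inv k p
                     * S2 inv (- lam) n k (x - ι k))
  β-Stirling-expansion inv inv-correct lam lamInv p n x = begin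
    fact n * (subst coeff y ⊛ negT (expS inv lam (- x))) n
      ≈⟨ *-congˡ (⊛-cong (subst-cong coeff y≋u) negT-E n) ⟩
    fact n * (subst coeff u ⊛ E x) n                       ≈⟨ *-congˡ (subst-⊛ u₀≈0 coeff (E x) n) ⟩
    fact n * sumTo n (λ k → coeff k * (spow u k ⊛ E x) n)  ≈⟨ *-distribˡ-sumTo n _ _ ⟩
    sumTo n (λ k → fact n * (coeff k * (spow u k ⊛ E x) n))
      ≈⟨ sumTo-cong n (λ k → trans (*-congˡ (*-congˡ (spow-u⊛E k x n))) (rearrange _ _ _ _ _ _)) ⟩
    sumTo n (λ k → pow (- lam) k * fall 1# (suc k) lamInv * invPowZ inv k p
                   * S2 inv (- lam) n k (x - ι k)) ∎
    where
    open DegenerateExponential inv inv-correct (- lam)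
    coeff : ℕ → Carrier
    coeff = LiOverYCoeff inv lam lamInv p
    y : Series
    y = oneS ⊕ (⊖ negT (expS inv lam 1#))
    y≋u : y ≋ u
    y≋u = ⊕-cong ≋-refl (⊖-cong (negT-expS inv lam 1#))
    negT-E : negT (expS inv lam (- x)) ≋ E x
    negT-E = ≋-trans (negT-expS inv lam (- x)) (E-cong (-‿involutive x))
    rearrange : ∀ N P F I Q X → N * (((P * F) * I) * Q * X) ≈ P * F * Q * (N * (I * X))
    rearrange = solve 6 (λ N P F I Q X →
                  (N :* (((P :* F) :* I) :* Q :* X)) := (P :* F :* Q :* (N :* (I :* X)))) refl

theorem7 : {c ℓ : Level} (R : CommutativeRing c ℓ) →
    let open CommutativeRing R
        open Gen R
    in (inv : ℕ → Carrier) → (∀ m → ι (suc m) * inv m ≈ 1#) →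
       (lam lamInv : Carrier) → lam * lamInv ≈ 1# →
       (p : ℤ) (n : ℕ) (x : Carrier) →
       β inv lam lamInv p n x ≈
         sumTo n (λ k → pow (- lam) k * fall 1# (suc k) lamInv * invPowZ inv k p
                        * S2 inv (- lam) n k (x - ι k))
theorem7 R inv inv-correct lam lamInv _ = PolyBernoulli.β-Stirling-expansion R inv inv-correct lam lamInv
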